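{- Let $n \ge 3$ and $2 \le k \le n-1$. Let $A$ be a solution to the $k$-out-of-$(n-1)$ puzzle and $B$ a solution to the $(k-1)$-out-of-$(n-1)$ puzzle, both expressions in the variables $\{1,\dots,n-1\}$. Define $H = A + n + B - A - n$. Then $H$ is a solution to the $k$-out-of-$n$ puzzle on the variables $\{1,\dots,n\}$.
   Context: Expressions are elements of the free group on the variables (nails), written additively: $+$ is the non-commutative group operation, $-x$ the inverse, $0$ the identity; in $H$, $n$ denotes the generator (nail) $n$. For a set $S$ of nails, $w|_S$ denotes $w$ with every variable in $S$ set to $0$. A solution to the $k$-out-of-$N$ puzzle on nails $\{1,\dots,N\}$ (Demaine's convention) is an expression $w$ in those variables with $w \ne 0$, $w|_S = 0$ for every set $S$ of $k$ nails, and $w|_S \ne 0$ for every set $S$ of fewer than $k$ nails. -}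

module Defs where

open import Data.Bool using (Bool; true; false; not; if_then_else_; _xor_)
open import Data.Nat using (ℕ; _≤_; _<_; _≡ᵇ_)
open import Data.Product using (_×_; _,_; proj₁; proj₂)
open import Data.List using (List; []; _∷_; _++_; reverse; map; filter; length)
open import Data.List.Membership.Propositional using (_∈_; _∉_)
open import Data.List.Membership.DecPropositional Data.Nat._≟_ using (_∈?_)
open import Data.List.Relation.Unary.All using (All)
open import Data.List.Relation.Unary.Unique.Propositional using (Unique)
open import Relation.Binary.PropositionalEquality using (_≡_)
open import Relation.Nullary using (¬_; does)

-- Free group on variables ℕ, modelled by words.
-- A letter (b , x): b = true means the generator x, b = false means -x.
Letter : Set
Letter = Bool × ℕ

Expr : Set
Expr = List Letter

gen : ℕ → Expr
gen x = (true , x) ∷ []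

0ₑ : Expr
0ₑ = []

infixl 6 _⊕_ _⊖_
_⊕_ : Expr → Expr → Expr
_⊕_ = _++_

invLetter : Letter → Letter
invLetter (b , x) = (not b , x)

⊖_ : Expr → Expr
⊖ w = reverse (map invLetter w)

_⊖_ : Expr → Expr → Expr
u ⊖ v = u ⊕ (⊖ v)

cancels : Letter → Letter → Bool
cancels (b , x) (c , y) = if x ≡ᵇ y then b xor c else false

push : Letter → List Letter → List Letter
push l [] = l ∷ []
push l (m ∷ st) = if cancels l m then st else l ∷ m ∷ st

-- reduced word (returned in reversed order; only emptiness/equality matters)
reduceRev : List Letter → List Letter → List Letter
reduceRev st [] = st
reduceRev st (l ∷ w) = reduceRev (push l st) w

reduce : Expr → List Letter
reduce w = reverse (reduceRev [] w)

_≈_ : Expr → Expr → Set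
u ≈ v = reduce u ≡ reduce v

-- w|_S : set every variable in S to 0 (delete those letters)
restrict : Expr → List ℕ → Expr
restrict w S = filter (λ l → ¬? (proj₂ l ∈? S)) w
  where open import Relation.Nullary using (¬?)

InVars : ℕ → Expr → Set
InVars N w = All (λ l → 1 ≤ proj₂ l × proj₂ l ≤ N) w

NailSet : ℕ → List ℕ → Set
NailSet N S = Unique S × All (λ x → 1 ≤ x × x ≤ N) S

Solution : ℕ → ℕ → Expr → Set
Solution k N w =
  InVars N w
  × ¬ (w ≈ 0ₑ)
  × (∀ S → NailSet N S → length S ≡ k → restrict w S ≈ 0ₑ)
  × (∀ S → NailSet N S → length S < k → ¬ (restrict w S ≈ 0ₑ))

-- Let H = A + n + B − A − n and S a set of nails. If n ∈ S then H|S is the conjugate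
-- A|S + B|S − A|S, which vanishes exactly when B|S does, i.e. when S ∖ {n} has at least
-- k − 1 nails. If n ∉ S then H|S = A′ + n + B′ − A′ − n with A′, B′ free of n: it vanishes
-- when A′ and B′ do, and since no letter of A′ or B′ cancels against n, its reduced form is
-- either that of A′ or A′ + n + C − n with C ≠ 0, so it vanishes only if A′ does.
module Submission where

open import Defs
open import Data.Bool using (true; false; T)
open import Data.Bool.Properties using (not-involutive)
open import Data.Empty using (⊥-elim)
open import Data.Nat using (ℕ; suc; _≡ᵇ_; _≤_; _<_; _∸_; s≤s; z≤n; s<s⁻¹)
open import Data.Nat.Properties
  using (_≟_; ≡ᵇ⇒≡; ≡⇒≡ᵇ; suc-injective; ≤-refl; ≤-trans; n≤1+n; 1+n≰n; ≤∧≢⇒<; m<1+n⇒m≤n)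
open import Data.Product using (_×_; _,_; proj₂; ∃-syntax)
open import Data.Sum using ([_,_]′)
open import Function using (_∘_)
open import Relation.Binary.Bundles using (Setoid)
open import Relation.Binary.PropositionalEquality hiding ([_])
open import Relation.Nullary using (¬_; Dec; yes; no)
open import Data.List using (List; []; _∷_; _++_; [_]; reverse; map; length)
open import Data.List.Properties
  using (++-assoc; ++-identityʳ; map-++; map-∘; map-id; map-cong; unfold-reverse; reverse-++; reverse-map;
         reverse-involutive; filter-++; filter-accept; filter-reject; filter-all; filter-≐)
open import Data.List.Membership.Propositional using (_∈_; _∉_)
open import Data.List.Membership.Propositional.Properties using (∈-∃++; ∈-++⁺ˡ; ∈-++⁺ʳ; ∈-++⁻)
open import Data.List.Membership.DecPropositional _≟_ using (_∈?_; _∉?_)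
open import Data.List.Relation.Binary.Permutation.Setoid (setoid ℕ) using (_↭_; ↭-sym)
open import Data.List.Relation.Binary.Permutation.Setoid.Properties (setoid ℕ)
  using (↭-shift; ∈-resp-↭; All-resp-↭; Unique-resp-↭; xs↭ys⇒|xs|≡|ys|)
open import Data.List.Relation.Unary.All as All using (All; []; _∷_)
import Data.List.Relation.Unary.All.Properties as All
open import Data.List.Relation.Unary.AllPairs using ([]; _∷_)
open import Data.List.Relation.Unary.Any using (here)
open import Data.List.Relation.Unary.Linked as Linked using (Linked; [-]; _∷_)
open import Data.List.Relation.Unary.Unique.Propositional.Properties using (Unique[x∷xs]⇒x∉xs)

≡ᵇ≡true⇒≡ : ∀ x y → (x ≡ᵇ y) ≡ true → x ≡ y
≡ᵇ≡true⇒≡ x y x≡ᵇy = ≡ᵇ⇒≡ x y (subst T (sym x≡ᵇy) _)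

invLetter-involutive : ∀ l → invLetter (invLetter l) ≡ l
invLetter-involutive (b , x) = cong (_, x) (not-involutive b)

cancels-inverse : ∀ l → cancels (invLetter l) l ≡ true
cancels-inverse (b , x) with x ≡ᵇ x | ≡⇒≡ᵇ x x refl
cancels-inverse (true , x)  | true  | _ = refl
cancels-inverse (false , x) | true  | _ = refl
cancels-inverse (b , x)     | false | ()

cancels⇒inverse : ∀ l m → cancels l m ≡ true → m ≡ invLetter l
cancels⇒inverse (b , x) (c , y) eq with x ≡ᵇ y in x≡ᵇy
cancels⇒inverse (true , x)  (false , y) _  | true = cong (false ,_) (sym (≡ᵇ≡true⇒≡ x y x≡ᵇy))
cancels⇒inverse (false , x) (true , y)  _  | true = cong (true ,_) (sym (≡ᵇ≡true⇒≡ x y x≡ᵇy))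
cancels⇒inverse (true , x)  (true , y)  () | true
cancels⇒inverse (false , x) (false , y) () | true
cancels⇒inverse (b , x)     (c , y)     () | false

cancels-≢ : ∀ l m → proj₂ l ≢ proj₂ m → cancels l m ≡ false
cancels-≢ (b , x) (c , y) x≢y with x ≡ᵇ y in x≡ᵇy
... | false = refl
... | true  = ⊥-elim (x≢y (≡ᵇ≡true⇒≡ x y x≡ᵇy))

Reduced : List Letter → Set
Reduced = Linked (λ l m → cancels l m ≡ false)

push-reduced : ∀ l {s} → Reduced s → Reduced (push l s)
push-reduced l {[]}    _ = [-]
push-reduced l {m ∷ s} r with cancels l m in c
... | true  = Linked.tail r
... | false = c ∷ r

reduceRev-reduced : ∀ {s} w → Reduced s → Reduced (reduceRev s w)
reduceRev-reduced []      r = r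
reduceRev-reduced (l ∷ w) r = reduceRev-reduced w (push-reduced l r)

reduceRev-++ : ∀ s u v → reduceRev s (u ++ v) ≡ reduceRev (reduceRev s u) v
reduceRev-++ s []      v = refl
reduceRev-++ s (l ∷ u) v = reduceRev-++ (push l s) u v

push-head : ∀ {l} s → Reduced (l ∷ s) → push l s ≡ l ∷ s
push-head []      _       = refl
push-head (m ∷ s) (c ∷ _) rewrite c = refl

push-cancel : ∀ {l m} s → cancels l m ≡ true → Reduced s → push l (push m s) ≡ s
push-cancel [] c _ rewrite c = refl
push-cancel {l} {m} (p ∷ s) c r with cancels m p in c′
... | false rewrite c = refl
... | true  = subst (λ q → push q s ≡ p ∷ s) p≡l (push-head s r)
  where
  open ≡-Reasoning
  p≡l : p ≡ l
  p≡l = begin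
    p                        ≡⟨ cancels⇒inverse m p c′ ⟩
    invLetter m              ≡⟨ cong invLetter (cancels⇒inverse l m c) ⟩
    invLetter (invLetter l)  ≡⟨ invLetter-involutive l ⟩
    l                        ∎

reduceRev-reverse-push : ∀ {s} l r → Reduced s →
  reduceRev s (reverse (push l r)) ≡ push l (reduceRev s (reverse r))
reduceRev-reverse-push l [] _ = refl
reduceRev-reverse-push {s} l (m ∷ r) rs with cancels l m in c
... | true rewrite unfold-reverse m r | reduceRev-++ s (reverse r) [ m ] =
  sym (push-cancel _ c (reduceRev-reduced (reverse r) rs))
... | false rewrite unfold-reverse l (m ∷ r) | reduceRev-++ s (reverse (m ∷ r)) [ l ] = refl

-- Confluence of free reduction: a reduced stack acts on a word only through its reduced form.
reduceRev-reverse-reduceRev : ∀ {s} r v → Reduced s →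
  reduceRev s (reverse (reduceRev r v)) ≡ reduceRev (reduceRev s (reverse r)) v
reduceRev-reverse-reduceRev r []      _  = refl
reduceRev-reverse-reduceRev r (l ∷ v) rs
  rewrite reduceRev-reverse-reduceRev (push l r) v rs | reduceRev-reverse-push l r rs = refl

reduceRev-cong : ∀ {s} u v → Reduced s → u ≈ v → reduceRev s u ≡ reduceRev s v
reduceRev-cong {s} u v rs u≈v = begin
  reduceRev s u           ≡⟨ reduceRev-reverse-reduceRev [] u rs ⟨
  reduceRev s (reduce u)  ≡⟨ cong (reduceRev s) u≈v ⟩
  reduceRev s (reduce v)  ≡⟨ reduceRev-reverse-reduceRev [] v rs ⟩
  reduceRev s v           ∎
  where open ≡-Reasoning

⟪_⟫ : Expr → List Letter
⟪ w ⟫ = reduceRev [] w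

⟪⟫-reduced : ∀ w → Reduced ⟪ w ⟫
⟪⟫-reduced w = reduceRev-reduced w Linked.[]

⟪⟫-cong : ∀ u v → u ≈ v → ⟪ u ⟫ ≡ ⟪ v ⟫
⟪⟫-cong u v = reduceRev-cong u v Linked.[]

⟪⟫⇒≈ : ∀ u v → ⟪ u ⟫ ≡ ⟪ v ⟫ → u ≈ v
⟪⟫⇒≈ u v = cong reverse

≈-setoid : Setoid _ _
≈-setoid = record
  { Carrier       = Expr
  ; _≈_           = _≈_
  ; isEquivalence = record { refl = refl ; sym = sym ; trans = trans }
  }

⊕-congʳ : ∀ u v w → u ≈ v → (u ⊕ w) ≈ (v ⊕ w)
⊕-congʳ u v w u≈v = ⟪⟫⇒≈ (u ⊕ w) (v ⊕ w) (begin
  ⟪ u ⊕ w ⟫          ≡⟨ reduceRev-++ [] u w ⟩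
  reduceRev ⟪ u ⟫ w  ≡⟨ cong (λ s → reduceRev s w) (⟪⟫-cong u v u≈v) ⟩
  reduceRev ⟪ v ⟫ w  ≡⟨ reduceRev-++ [] v w ⟨
  ⟪ v ⊕ w ⟫          ∎)
  where open ≡-Reasoning

⊕-congˡ : ∀ w u v → u ≈ v → (w ⊕ u) ≈ (w ⊕ v)
⊕-congˡ w u v u≈v = ⟪⟫⇒≈ (w ⊕ u) (w ⊕ v) (begin
  ⟪ w ⊕ u ⟫          ≡⟨ reduceRev-++ [] w u ⟩
  reduceRev ⟪ w ⟫ u  ≡⟨ reduceRev-cong u v (⟪⟫-reduced w) u≈v ⟩
  reduceRev ⟪ w ⟫ v  ≡⟨ reduceRev-++ [] w v ⟨
  ⟪ w ⊕ v ⟫          ∎)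
  where open ≡-Reasoning

⊕-identityʳ-≈ : ∀ u v → v ≈ 0ₑ → (u ⊕ v) ≈ u
⊕-identityʳ-≈ u v v≈0 = trans (⊕-congˡ u v [] v≈0) (cong reduce (++-identityʳ u))

⊖-∷ : ∀ l u → ⊖ (l ∷ u) ≡ ⊖ u ⊕ [ invLetter l ]
⊖-∷ l u = unfold-reverse (invLetter l) (map invLetter u)

⊖-⊕ : ∀ u v → ⊖ (u ⊕ v) ≡ ⊖ v ⊕ ⊖ u
⊖-⊕ u v = trans (cong reverse (map-++ invLetter u v)) (reverse-++ (map invLetter u) (map invLetter v))

⊖-involutive : ∀ u → ⊖ (⊖ u) ≡ u
⊖-involutive u = begin
  reverse (map invLetter (reverse (map invLetter u)))
    ≡⟨ cong reverse (reverse-map invLetter (map invLetter u)) ⟩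
  reverse (reverse (map invLetter (map invLetter u)))
    ≡⟨ reverse-involutive _ ⟩
  map invLetter (map invLetter u)
    ≡⟨ map-∘ u ⟨
  map (invLetter ∘ invLetter) u
    ≡⟨ map-cong invLetter-involutive u ⟩
  map (λ l → l) u
    ≡⟨ map-id u ⟩
  u
    ∎
  where open ≡-Reasoning

reduceRev-inverseʳ : ∀ {s} u → Reduced s → reduceRev s (u ⊖ u) ≡ s
reduceRev-inverseʳ []          _  = refl
reduceRev-inverseʳ {s} (l ∷ u) rs = begin
  reduceRev (push l s) (u ⊕ ⊖ (l ∷ u))
    ≡⟨ cong (λ v → reduceRev (push l s) (u ⊕ v)) (⊖-∷ l u) ⟩
  reduceRev (push l s) (u ⊕ (⊖ u ⊕ [ invLetter l ]))
    ≡⟨ cong (reduceRev (push l s)) (++-assoc u (⊖ u) _) ⟨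
  reduceRev (push l s) (u ⊖ u ⊕ [ invLetter l ])
    ≡⟨ reduceRev-++ (push l s) (u ⊖ u) _ ⟩
  push (invLetter l) (reduceRev (push l s) (u ⊖ u))
    ≡⟨ cong (push (invLetter l)) (reduceRev-inverseʳ u (push-reduced l rs)) ⟩
  push (invLetter l) (push l s)
    ≡⟨ push-cancel s (cancels-inverse l) rs ⟩
  s
    ∎
  where open ≡-Reasoning

⊖-inverseʳ : ∀ u → (u ⊖ u) ≈ 0ₑ
⊖-inverseʳ u = cong reverse (reduceRev-inverseʳ u Linked.[])

⊖-inverseˡ : ∀ u → (⊖ u ⊕ u) ≈ 0ₑ
⊖-inverseˡ u = subst (λ v → (⊖ u ⊕ v) ≈ 0ₑ) (⊖-involutive u) (⊖-inverseʳ (⊖ u))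

⊖-≈0 : ∀ u → u ≈ 0ₑ → (⊖ u) ≈ 0ₑ
⊖-≈0 u u≈0 = trans (sym (⊕-identityʳ-≈ (⊖ u) u u≈0)) (⊖-inverseˡ u)

conjugate-≈0⇐ : ∀ a b → b ≈ 0ₑ → (a ⊕ b ⊖ a) ≈ 0ₑ
conjugate-≈0⇐ a b b≈0 = trans (⊕-congʳ (a ⊕ b) a (⊖ a) (⊕-identityʳ-≈ a b b≈0)) (⊖-inverseʳ a)

conjugate-≈0⇒ : ∀ a b → (a ⊕ b ⊖ a) ≈ 0ₑ → b ≈ 0ₑ
conjugate-≈0⇒ a b e = begin
  b                      ≈⟨ ⊕-congʳ (⊖ a ⊕ a) [] b (⊖-inverseˡ a) ⟨
  ⊖ a ⊕ a ⊕ b            ≡⟨ ++-assoc (⊖ a) a b ⟩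
  ⊖ a ⊕ (a ⊕ b)          ≈⟨ ⊕-congˡ (⊖ a) (a ⊕ b ⊖ a ⊕ a) (a ⊕ b) unconjugate ⟨
  ⊖ a ⊕ (a ⊕ b ⊖ a ⊕ a)  ≈⟨ ⊕-congˡ (⊖ a) (a ⊕ b ⊖ a ⊕ a) a (⊕-congʳ (a ⊕ b ⊖ a) [] a e) ⟩
  ⊖ a ⊕ a                ≈⟨ ⊖-inverseˡ a ⟩
  0ₑ                     ∎
  where
  open import Relation.Binary.Reasoning.Setoid ≈-setoid
  unconjugate : (a ⊕ b ⊖ a ⊕ a) ≈ (a ⊕ b)
  unconjugate = trans (cong reduce (++-assoc (a ⊕ b) (⊖ a) a))
                      (⊕-identityʳ-≈ (a ⊕ b) (⊖ a ⊕ a) (⊖-inverseˡ a))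

restrict-⊕ : ∀ u v S → restrict (u ⊕ v) S ≡ restrict u S ⊕ restrict v S
restrict-⊕ u v S = filter-++ (λ l → proj₂ l ∉? S) u v

restrict-∷-∈ : ∀ {l} w {S} → proj₂ l ∈ S → restrict (l ∷ w) S ≡ restrict w S
restrict-∷-∈ w {S} l∈S = filter-reject (λ l → proj₂ l ∉? S) (λ l∉S → l∉S l∈S)

restrict-∷-∉ : ∀ {l} w {S} → proj₂ l ∉ S → restrict (l ∷ w) S ≡ l ∷ restrict w S
restrict-∷-∉ w {S} = filter-accept (λ l → proj₂ l ∉? S)

restrict-All : ∀ {P : Letter → Set} S w → All P w → All P (restrict w S)
restrict-All S w = All.filter⁺ (λ l → proj₂ l ∉? S)

restrict-invLetter : ∀ l S → restrict [ invLetter l ] S ≡ ⊖ (restrict [ l ] S)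
restrict-invLetter (b , x) S with x ∈? S
... | yes _ = refl
... | no  _ = refl

restrict-⊖ : ∀ u S → restrict (⊖ u) S ≡ ⊖ (restrict u S)
restrict-⊖ []      S = refl
restrict-⊖ (l ∷ u) S = begin
  restrict (⊖ (l ∷ u)) S
    ≡⟨ cong (λ v → restrict v S) (⊖-∷ l u) ⟩
  restrict (⊖ u ⊕ [ invLetter l ]) S
    ≡⟨ restrict-⊕ (⊖ u) _ S ⟩
  restrict (⊖ u) S ⊕ restrict [ invLetter l ] S
    ≡⟨ cong₂ _⊕_ (restrict-⊖ u S) (restrict-invLetter l S) ⟩
  ⊖ (restrict u S) ⊕ ⊖ (restrict [ l ] S)
    ≡⟨ ⊖-⊕ (restrict [ l ] S) (restrict u S) ⟨
  ⊖ (restrict [ l ] S ⊕ restrict u S)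
    ≡⟨ cong ⊖_ (restrict-⊕ [ l ] u S) ⟨
  ⊖ (restrict (l ∷ u) S)
    ∎
  where open ≡-Reasoning

restrict-restrict : ∀ w T U → restrict (restrict w T) U ≡ restrict w (U ++ T)
restrict-restrict []      T U = refl
restrict-restrict (l ∷ w) T U = by-membership (proj₂ l ∈? T) (proj₂ l ∈? U)
  where
  IH = restrict-restrict w T U
  by-membership : Dec (proj₂ l ∈ T) → Dec (proj₂ l ∈ U) →
                  restrict (restrict (l ∷ w) T) U ≡ restrict (l ∷ w) (U ++ T)
  by-membership (yes l∈T) _ =
    trans (cong (λ v → restrict v U) (restrict-∷-∈ w l∈T))
      (trans IH (sym (restrict-∷-∈ w (∈-++⁺ʳ U l∈T))))
  by-membership (no l∉T) (yes l∈U) =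
    trans (cong (λ v → restrict v U) (restrict-∷-∉ w l∉T))
      (trans (restrict-∷-∈ (restrict w T) l∈U) (trans IH (sym (restrict-∷-∈ w (∈-++⁺ˡ l∈U)))))
  by-membership (no l∉T) (no l∉U) =
    trans (cong (λ v → restrict v U) (restrict-∷-∉ w l∉T))
      (trans (restrict-∷-∉ (restrict w T) l∉U)
        (trans (cong (l ∷_) IH) (sym (restrict-∷-∉ w ([ l∉U , l∉T ]′ ∘ ∈-++⁻ U)))))

restrict-resp-↭ : ∀ w {S T} → S ↭ T → restrict w S ≡ restrict w T
restrict-resp-↭ w {S} {T} S↭T = filter-≐ (λ l → proj₂ l ∉? S) (λ l → proj₂ l ∉? T)
  ((λ ∉S ∈T → ∉S (∈-resp-↭ (↭-sym S↭T) ∈T)) , (λ ∉T ∈S → ∉T (∈-resp-↭ S↭T ∈S))) w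

-- restrictStack S s is the stack of the restriction of the word that s encodes; commuting it
-- with reduceRev is what makes restriction compatible with free reduction.
restrictStack : List ℕ → List Letter → List Letter
restrictStack S s = ⟪ restrict (reverse s) S ⟫

restrictStack-∷ : ∀ S l s → restrictStack S (l ∷ s) ≡ reduceRev (restrictStack S s) (restrict [ l ] S)
restrictStack-∷ S l s = begin
  ⟪ restrict (reverse (l ∷ s)) S ⟫
    ≡⟨ cong (λ v → ⟪ restrict v S ⟫) (unfold-reverse l s) ⟩
  ⟪ restrict (reverse s ⊕ [ l ]) S ⟫
    ≡⟨ cong ⟪_⟫ (restrict-⊕ (reverse s) [ l ] S) ⟩
  ⟪ restrict (reverse s) S ⊕ restrict [ l ] S ⟫
    ≡⟨ reduceRev-++ [] (restrict (reverse s) S) _ ⟩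
  reduceRev (restrictStack S s) (restrict [ l ] S)
    ∎
  where open ≡-Reasoning

reduceRev-restrict-cancel : ∀ {l m t} S → cancels l m ≡ true → Reduced t →
  reduceRev (reduceRev t (restrict [ m ] S)) (restrict [ l ] S) ≡ t
reduceRev-restrict-cancel {l} {m} S c rt with cancels⇒inverse l m c
... | refl with proj₂ l ∈? S
...   | yes _ = refl
...   | no  _ = push-cancel _ c rt

restrictStack-push : ∀ S l s → restrictStack S (push l s) ≡ reduceRev (restrictStack S s) (restrict [ l ] S)
restrictStack-push S l []      = refl
restrictStack-push S l (m ∷ s) with cancels l m in c
... | false = restrictStack-∷ S l (m ∷ s)
... | true  = sym (begin
  reduceRev (restrictStack S (m ∷ s)) (restrict [ l ] S)
    ≡⟨ cong (λ t → reduceRev t (restrict [ l ] S)) (restrictStack-∷ S m s) ⟩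
  reduceRev (reduceRev (restrictStack S s) (restrict [ m ] S)) (restrict [ l ] S)
    ≡⟨ reduceRev-restrict-cancel S c (⟪⟫-reduced (restrict (reverse s) S)) ⟩
  restrictStack S s
    ∎)
  where open ≡-Reasoning

restrictStack-reduceRev : ∀ S s w →
  restrictStack S (reduceRev s w) ≡ reduceRev (restrictStack S s) (restrict w S)
restrictStack-reduceRev S s []      = refl
restrictStack-reduceRev S s (l ∷ w) = begin
  restrictStack S (reduceRev (push l s) w)
    ≡⟨ restrictStack-reduceRev S (push l s) w ⟩
  reduceRev (restrictStack S (push l s)) (restrict w S)
    ≡⟨ cong (λ t → reduceRev t (restrict w S)) (restrictStack-push S l s) ⟩
  reduceRev (reduceRev (restrictStack S s) (restrict [ l ] S)) (restrict w S)
    ≡⟨ reduceRev-++ _ (restrict [ l ] S) _ ⟨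
  reduceRev (restrictStack S s) (restrict [ l ] S ⊕ restrict w S)
    ≡⟨ cong (reduceRev _) (restrict-⊕ [ l ] w S) ⟨
  reduceRev (restrictStack S s) (restrict (l ∷ w) S)
    ∎
  where open ≡-Reasoning

restrict-cong : ∀ u v S → u ≈ v → restrict u S ≈ restrict v S
restrict-cong u v S u≈v = ⟪⟫⇒≈ (restrict u S) (restrict v S) (begin
  ⟪ restrict u S ⟫       ≡⟨ restrictStack-reduceRev S [] u ⟨
  restrictStack S ⟪ u ⟫  ≡⟨ cong (restrictStack S) (⟪⟫-cong u v u≈v) ⟩
  restrictStack S ⟪ v ⟫  ≡⟨ restrictStack-reduceRev S [] v ⟩
  ⟪ restrict v S ⟫       ∎)
  where open ≡-Reasoning

restrict-∷-≈0 : ∀ {x} w S → restrict w S ≈ 0ₑ → restrict w (x ∷ S) ≈ 0ₑ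
restrict-∷-≈0 {x} w S w≈0 =
  subst (_≈ 0ₑ) (restrict-restrict w S [ x ]) (restrict-cong (restrict w S) [] [ x ] w≈0)

Avoid : ℕ → Expr → Set
Avoid x = All (λ l → proj₂ l ≢ x)

All-⊖ : ∀ {P : ℕ → Set} u → All (P ∘ proj₂) u → All (P ∘ proj₂) (⊖ u)
All-⊖ []      []       = []
All-⊖ (l ∷ u) (p ∷ ps) = subst (All _) (sym (⊖-∷ l u)) (All.++⁺ (All-⊖ u ps) (p ∷ []))

restrict-fresh : ∀ {x} w S → Avoid x w → restrict w (x ∷ S) ≡ restrict w S
restrict-fresh {x} w S xw = trans (sym (restrict-restrict w S [ x ]))
  (filter-all (λ l → proj₂ l ∉? [ x ]) (All.map (λ { l≢x (here e) → l≢x e }) (restrict-All S w xw)))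

push-avoid : ∀ {x l} s → Avoid x s → proj₂ l ≢ x → Avoid x (push l s)
push-avoid         []      _          l≢x = l≢x ∷ []
push-avoid {l = l} (m ∷ s) (m≢x ∷ ms) l≢x with cancels l m
... | true  = ms
... | false = l≢x ∷ m≢x ∷ ms

reduceRev-avoid : ∀ {x s} w → Avoid x s → Avoid x w → Avoid x (reduceRev s w)
reduceRev-avoid         []      xs _          = xs
reduceRev-avoid {s = s} (l ∷ w) xs (l≢x ∷ xw) = reduceRev-avoid w (push-avoid s xs l≢x) xw

push-above : ∀ {l m} s X → proj₂ l ≢ proj₂ m → push l (s ++ m ∷ X) ≡ push l s ++ m ∷ X
push-above {l} {m} []      X l≢m rewrite cancels-≢ l m l≢m = refl
push-above {l}     (p ∷ s) X _ with cancels l p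
... | true  = refl
... | false = refl

reduceRev-above : ∀ {m} s X v → Avoid (proj₂ m) v → reduceRev (s ++ m ∷ X) v ≡ reduceRev s v ++ m ∷ X
reduceRev-above     s X []      []         = refl
reduceRev-above {m} s X (l ∷ v) (l≢m ∷ ls) =
  trans (cong (λ t → reduceRev t v) (push-above {m = m} s X l≢m)) (reduceRev-above (push l s) X v ls)

push-fresh : ∀ {l} s → Avoid (proj₂ l) s → push l s ≡ l ∷ s
push-fresh []      _         = refl
push-fresh (m ∷ s) (m≢l ∷ _) = push-above [] s (m≢l ∘ sym)

push-inverse-above : ∀ {x s} Z → Avoid x Z → push (false , x) (Z ++ (true , x) ∷ s) ≡ [] → s ≡ []
push-inverse-above {x} []      _         e rewrite cancels-inverse (true , x) = e
push-inverse-above {x} (p ∷ Z) (p≢x ∷ _) e with cancels (false , x) p | cancels-≢ (false , x) p (p≢x ∘ sym)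
push-inverse-above {x} (p ∷ Z) (p≢x ∷ _) () | false | refl

extend : ℕ → Expr → Expr → Expr
extend x a b = a ⊕ gen x ⊕ b ⊖ a ⊖ gen x

extend-InVars : ∀ {N x a b} → 1 ≤ x → x ≤ N → InVars N a → InVars N b → InVars N (extend x a b)
extend-InVars {N} {x} {a} 1≤x x≤N as bs =
  All.++⁺ (All.++⁺ (All.++⁺ (All.++⁺ as xs) bs) (All-⊖ a as)) (All-⊖ (gen x) xs)
  where
  xs : InVars N (gen x)
  xs = (1≤x , x≤N) ∷ []

extend-≈0⇐ : ∀ x a b → a ≈ 0ₑ → b ≈ 0ₑ → extend x a b ≈ 0ₑ
extend-≈0⇐ x a b a≈0 b≈0 = begin
  a ⊕ g ⊕ b ⊖ a ⊖ g
    ≈⟨ ⊕-congʳ (a ⊕ g ⊕ b ⊖ a) (a ⊕ g ⊖ a) (⊖ g)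
         (⊕-congʳ (a ⊕ g ⊕ b) (a ⊕ g) (⊖ a) (⊕-identityʳ-≈ (a ⊕ g) b b≈0)) ⟩
  a ⊕ g ⊖ a ⊖ g
    ≈⟨ ⊕-congʳ (a ⊕ g ⊖ a) (a ⊕ g) (⊖ g) (⊕-identityʳ-≈ (a ⊕ g) (⊖ a) (⊖-≈0 a a≈0)) ⟩
  a ⊕ g ⊖ g
    ≡⟨ ++-assoc a g (⊖ g) ⟩
  a ⊕ (g ⊖ g)
    ≈⟨ ⊕-identityʳ-≈ a (g ⊖ g) (⊖-inverseʳ g) ⟩
  a
    ≈⟨ a≈0 ⟩
  0ₑ
    ∎
  where
  open import Relation.Binary.Reasoning.Setoid ≈-setoid
  g = gen x

⟪extend⟫ : ∀ x a b → Avoid x a → Avoid x b →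
  ⟪ extend x a b ⟫ ≡ push (false , x) (reduceRev ⟪ b ⟫ (⊖ a) ++ (true , x) ∷ ⟪ a ⟫)
⟪extend⟫ x a b xa xb = begin
  ⟪ a ⊕ gen x ⊕ b ⊖ a ⊖ gen x ⟫
    ≡⟨ reduceRev-++ [] (a ⊕ gen x ⊕ b ⊖ a) _ ⟩
  push (false , x) ⟪ a ⊕ gen x ⊕ b ⊖ a ⟫
    ≡⟨ cong (push (false , x)) (reduceRev-++ [] (a ⊕ gen x ⊕ b) (⊖ a)) ⟩
  push (false , x) (reduceRev ⟪ a ⊕ gen x ⊕ b ⟫ (⊖ a))
    ≡⟨ cong (λ s → push (false , x) (reduceRev s (⊖ a))) (reduceRev-++ [] (a ⊕ gen x) b) ⟩
  push (false , x) (reduceRev (reduceRev ⟪ a ⊕ gen x ⟫ b) (⊖ a))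
    ≡⟨ cong (λ s → push (false , x) (reduceRev (reduceRev s b) (⊖ a))) (reduceRev-++ [] a (gen x)) ⟩
  push (false , x) (reduceRev (reduceRev (push (true , x) ⟪ a ⟫) b) (⊖ a))
    ≡⟨ cong (λ s → push (false , x) (reduceRev (reduceRev s b) (⊖ a)))
            (push-fresh ⟪ a ⟫ (reduceRev-avoid a [] xa)) ⟩
  push (false , x) (reduceRev (reduceRev ((true , x) ∷ ⟪ a ⟫) b) (⊖ a))
    ≡⟨ cong (λ s → push (false , x) (reduceRev s (⊖ a))) (reduceRev-above [] ⟪ a ⟫ b xb) ⟩
  push (false , x) (reduceRev (⟪ b ⟫ ++ (true , x) ∷ ⟪ a ⟫) (⊖ a))
    ≡⟨ cong (push (false , x)) (reduceRev-above ⟪ b ⟫ ⟪ a ⟫ (⊖ a) (All-⊖ a xa)) ⟩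
  push (false , x) (reduceRev ⟪ b ⟫ (⊖ a) ++ (true , x) ∷ ⟪ a ⟫)
    ∎
  where open ≡-Reasoning

extend-≈0⇒ : ∀ x a b → Avoid x a → Avoid x b → extend x a b ≈ 0ₑ → a ≈ 0ₑ
extend-≈0⇒ x a b xa xb e = ⟪⟫⇒≈ a [] (push-inverse-above (reduceRev ⟪ b ⟫ (⊖ a)) middle-avoids
  (trans (sym (⟪extend⟫ x a b xa xb)) (⟪⟫-cong (extend x a b) [] e)))
  where
  middle-avoids : Avoid x (reduceRev ⟪ b ⟫ (⊖ a))
  middle-avoids = reduceRev-avoid (⊖ a) (reduceRev-avoid b [] xb) (All-⊖ a xa)

restrict-extend : ∀ x a b S → restrict (extend x a b) S
  ≡ restrict a S ⊕ restrict (gen x) S ⊕ restrict b S ⊖ restrict a S ⊖ restrict (gen x) S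
restrict-extend x a b S
  rewrite restrict-⊕ (a ⊕ gen x ⊕ b ⊖ a) (⊖ gen x) S | restrict-⊕ (a ⊕ gen x ⊕ b) (⊖ a) S
        | restrict-⊕ (a ⊕ gen x) b S | restrict-⊕ a (gen x) S
        | restrict-⊖ a S | restrict-⊖ (gen x) S = refl

restrict-extend-∉ : ∀ {x S} a b → x ∉ S →
  restrict (extend x a b) S ≡ extend x (restrict a S) (restrict b S)
restrict-extend-∉ {x} {S} a b x∉S =
  trans (restrict-extend x a b S) (cong (λ g → a′ ⊕ g ⊕ restrict b S ⊖ a′ ⊖ g) (restrict-∷-∉ [] x∉S))
  where a′ = restrict a S

restrict-extend-∈ : ∀ {x S} a b → x ∈ S →
  restrict (extend x a b) S ≡ restrict a S ⊕ restrict b S ⊖ restrict a S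
restrict-extend-∈ {x} {S} a b x∈S = begin
  restrict (extend x a b) S  ≡⟨ restrict-extend x a b S ⟩
  a′ ⊕ g ⊕ b′ ⊖ a′ ⊖ g       ≡⟨ cong (λ g → a′ ⊕ g ⊕ b′ ⊖ a′ ⊖ g) (restrict-∷-∈ [] x∈S) ⟩
  a′ ⊕ [] ⊕ b′ ⊖ a′ ⊕ []     ≡⟨ ++-identityʳ _ ⟩
  a′ ⊕ [] ⊕ b′ ⊖ a′          ≡⟨ cong (λ c → c ⊕ b′ ⊖ a′) (++-identityʳ a′) ⟩
  a′ ⊕ b′ ⊖ a′               ∎
  where
  open ≡-Reasoning
  a′ = restrict a S
  b′ = restrict b S
  g  = restrict (gen x) S

restrict-extend-↭ : ∀ {x S S′} a b → Avoid x b → S ↭ x ∷ S′ →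
  restrict (extend x a b) S ≡ restrict a S ⊕ restrict b S′ ⊖ restrict a S
restrict-extend-↭ {x} {S} {S′} a b xb S↭ =
  trans (restrict-extend-∈ a b (∈-resp-↭ (↭-sym S↭) (here refl)))
    (cong (λ b′ → restrict a S ⊕ b′ ⊖ restrict a S)
          (trans (restrict-resp-↭ b S↭) (restrict-fresh b S′ xb)))

∈⇒↭-∷ : ∀ {x : ℕ} {S} → x ∈ S → ∃[ S′ ] S ↭ x ∷ S′
∈⇒↭-∷ x∈S with S₁ , S₂ , refl ← ∈-∃++ x∈S = S₁ ++ S₂ , ↭-shift S₁ S₂

NailSet-resp-↭ : ∀ {N S T} → S ↭ T → NailSet N S → NailSet N T
NailSet-resp-↭ S↭T (unique , bounded) =
  Unique-resp-↭ S↭T unique , All-resp-↭ (λ { refl p → p }) S↭T bounded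

NailSet-tail : ∀ {N x S} → NailSet N (x ∷ S) → NailSet N S
NailSet-tail (_ ∷ unique , _ ∷ bounded) = unique , bounded

NailSet-pred : ∀ {m S} → NailSet (suc m) S → suc m ∉ S → NailSet m S
NailSet-pred {m} {S} (unique , bounded) m+1∉S = unique , All.tabulate below
  where
  below : ∀ {x} → x ∈ S → 1 ≤ x × x ≤ m
  below x∈S with 1≤x , x≤m+1 ← All.lookup bounded x∈S =
    1≤x , m<1+n⇒m≤n (≤∧≢⇒< x≤m+1 (λ { refl → m+1∉S x∈S }))

NailSet-split : ∀ {m S} → NailSet (suc m) S → suc m ∈ S → ∃[ S′ ] S ↭ suc m ∷ S′ × NailSet m S′
NailSet-split ns m+1∈S with S′ , S↭ ← ∈⇒↭-∷ m+1∈S with NailSet-resp-↭ S↭ ns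
... | ns″@(unique , _) = S′ , S↭ , NailSet-pred (NailSet-tail ns″) (Unique[x∷xs]⇒x∉xs unique)

InVars-suc : ∀ {m w} → InVars m w → InVars (suc m) w
InVars-suc {m} = All.map (λ (1≤x , x≤m) → 1≤x , ≤-trans x≤m (n≤1+n m))

InVars⇒Avoid : ∀ {m w} → InVars m w → Avoid (suc m) w
InVars⇒Avoid {m} = All.map (λ (_ , x≤m) x≡m+1 → 1+n≰n (subst (_≤ m) x≡m+1 x≤m))

extend-vanishes : ∀ {m k A B} → Solution (suc k) m A → Solution k m B →
  ∀ S → NailSet (suc m) S → length S ≡ suc k → restrict (extend (suc m) A B) S ≈ 0ₑ
extend-vanishes {m} {k} {A} {B} _ (B-vars , _ , B-vanishes , _) S ns |S| with suc m ∈? S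
... | yes m+1∈S with S′ , S↭ , ns′ ← NailSet-split ns m+1∈S =
  subst (_≈ 0ₑ) (sym (restrict-extend-↭ A B (InVars⇒Avoid B-vars) S↭))
    (conjugate-≈0⇐ (restrict A S) (restrict B S′) (B-vanishes S′ ns′ |S′|))
  where
  |S′| : length S′ ≡ k
  |S′| = suc-injective (trans (sym (xs↭ys⇒|xs|≡|ys| S↭)) |S|)
extend-vanishes {m} {A = A} {B} (_ , _ , A-vanishes , _) (_ , _ , B-vanishes , _) (x ∷ S) ns |S| | no m+1∉S =
  subst (_≈ 0ₑ) (sym (restrict-extend-∉ A B m+1∉S))
    (extend-≈0⇐ (suc m) (restrict A (x ∷ S)) (restrict B (x ∷ S))
      (A-vanishes (x ∷ S) ns′ |S|)
      (restrict-∷-≈0 B S (B-vanishes S (NailSet-tail ns′) (suc-injective |S|))))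
  where
  ns′ = NailSet-pred ns m+1∉S

extend-survives : ∀ {m k A B} → Solution (suc k) m A → Solution k m B →
  ∀ S → NailSet (suc m) S → length S < suc k → ¬ (restrict (extend (suc m) A B) S ≈ 0ₑ)
extend-survives {m} {k} {A} {B} (A-vars , _ , _ , A-survives) (B-vars , _ , _ , B-survives) S ns |S| H≈0
  with suc m ∈? S
... | yes m+1∈S with S′ , S↭ , ns′ ← NailSet-split ns m+1∈S =
  B-survives S′ ns′ (s<s⁻¹ (subst (_< suc k) (xs↭ys⇒|xs|≡|ys| S↭) |S|))
    (conjugate-≈0⇒ (restrict A S) (restrict B S′)
      (subst (_≈ 0ₑ) (restrict-extend-↭ A B (InVars⇒Avoid B-vars) S↭) H≈0))
... | no m+1∉S =
  A-survives S (NailSet-pred ns m+1∉S) |S|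
    (extend-≈0⇒ (suc m) (restrict A S) (restrict B S)
      (restrict-All S A (InVars⇒Avoid A-vars)) (restrict-All S B (InVars⇒Avoid B-vars))
      (subst (_≈ 0ₑ) (restrict-extend-∉ A B m+1∉S) H≈0))

proposition5p1 : (n k : ℕ) → 3 ≤ n → 2 ≤ k → k ≤ n ∸ 1 →
    (A B : Expr) → Solution k (n ∸ 1) A → Solution (k ∸ 1) (n ∸ 1) B →
    Solution k n (A ⊕ gen n ⊕ B ⊖ A ⊖ gen n)
proposition5p1 (suc m) (suc k) (s≤s _) (s≤s _) _ A B solA@(A-vars , _) solB@(B-vars , _) =
  extend-InVars (s≤s z≤n) ≤-refl (InVars-suc A-vars) (InVars-suc B-vars) ,
  (λ H≈0 → extend-survives solA solB [] ([] , []) (s≤s z≤n)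
             (restrict-cong (extend (suc m) A B) [] [] H≈0)) ,
  extend-vanishes solA solB ,
  extend-survives solA solB
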